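{- Let $p\in\{2,3\}$ and let $G\subseteq GL_2(\mathbb{Z}/p^2\mathbb{Z})$ be a subgroup which represents every pair $(t,d)\in(\mathbb{Z}/p^2\mathbb{Z})\times(\mathbb{Z}/p^2\mathbb{Z})^*$ and whose reduction modulo $p$ is all of $GL_2(\mathbb{Z}/p\mathbb{Z})$. Then $G=GL_2(\mathbb{Z}/p^2\mathbb{Z})$.
   Context: A subgroup $G\subseteq GL_2(\mathbb{Z}/W\mathbb{Z})$ represents a pair $(t,d)\in(\mathbb{Z}/W\mathbb{Z})\times(\mathbb{Z}/W\mathbb{Z})^*$ if some $g\in G$ has $\mathrm{tr}(g)=t$ and $\det(g)=d$. -}

module Defs where

open import Level using (Level; suc; _⊔_)
open import Data.Nat as ℕ using (ℕ; NonZero)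
open import Data.Nat.DivMod using (_%_; m%n<n)
open import Data.Fin using (Fin; toℕ; fromℕ<)
open import Data.Product using (Σ; ∃; _×_; _,_)
open import Relation.Binary.PropositionalEquality using (_≡_)

ZMod : ℕ → Set
ZMod n = Fin n

[_]_ : (n : ℕ) → .{{NonZero n}} → ℕ → ZMod n
([ n ] a) = fromℕ< (m%n<n a n)

module _ (n : ℕ) .{{_ : NonZero n}} where
  infixl 6 _+ₙ_ _-ₙ_
  infixl 7 _*ₙ_
  _+ₙ_ : ZMod n → ZMod n → ZMod n
  a +ₙ b = [ n ] (toℕ a ℕ.+ toℕ b)

  _*ₙ_ : ZMod n → ZMod n → ZMod n
  a *ₙ b = [ n ] (toℕ a ℕ.* toℕ b)

  _-ₙ_ : ZMod n → ZMod n → ZMod n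
  a -ₙ b = [ n ] (toℕ a ℕ.+ (n ℕ.∸ toℕ b))

  0ₙ 1ₙ : ZMod n
  0ₙ = [ n ] 0
  1ₙ = [ n ] 1

  IsUnit : ZMod n → Set
  IsUnit a = ∃ λ b → a *ₙ b ≡ 1ₙ

  -- 2×2 matrices over ℤ/nℤ:  mat a b c d  =  ( a b ; c d )
  record Mat : Set where
    constructor mat
    field
      a b c d : ZMod n

  tr : Mat → ZMod n
  tr (mat a b c d) = a +ₙ d

  det : Mat → ZMod n
  det (mat a b c d) = (a *ₙ d) -ₙ (b *ₙ c)

  _·_ : Mat → Mat → Mat
  mat a b c d · mat a' b' c' d' =
    mat (a *ₙ a' +ₙ b *ₙ c') (a *ₙ b' +ₙ b *ₙ d')
        (c *ₙ a' +ₙ d *ₙ c') (c *ₙ b' +ₙ d *ₙ d')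

  I₂ : Mat
  I₂ = mat 1ₙ 0ₙ 0ₙ 1ₙ

  InGL₂ : Mat → Set
  InGL₂ g = IsUnit (det g)

  record IsSubgroupGL₂ (G : Mat → Set) : Set where
    field
      ⊆GL₂   : ∀ g → G g → InGL₂ g
      has-I  : G I₂
      closed : ∀ g h → G g → G h → G (g · h)
      inv    : ∀ g → G g → ∃ λ h → G h × (g · h ≡ I₂) × (h · g ≡ I₂)

  Represents : (Mat → Set) → ZMod n → ZMod n → Set
  Represents G t d = ∃ λ g → G g × tr g ≡ t × det g ≡ d

-- reduction ℤ/mℤ → ℤ/nℤ (meaningful when n ∣ m)
red : (m n : ℕ) .{{_ : NonZero n}} → ZMod m → ZMod n
red m n x = [ n ] (toℕ x)

redMat : (m n : ℕ) .{{_ : NonZero m}} .{{_ : NonZero n}} → Mat m → Mat n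
redMat m n (mat a b c d) = mat (red m n a) (red m n b) (red m n c) (red m n d)

-- The kernel of the reduction GL₂(ℤ/p²) → GL₂(ℤ/p) consists of the matrices I + pA with
-- A ∈ M₂(𝔽ₚ), and (I + pA)(I + pB) = I + p(A + B). Hence 𝔤 = {A | I + pA ∈ G} is an additive
-- subgroup of M₂(𝔽ₚ), stable under conjugation by GL₂(𝔽ₚ) because G maps onto GL₂(𝔽ₚ); once
-- 𝔤 = M₂(𝔽ₚ), G contains the kernel and therefore all of GL₂(ℤ/p²).
-- To find an element of 𝔤, take g₁, g₂ ∈ G representing two suitable pairs (tᵢ, dᵢ). Kernel
-- elements satisfy tr = det + 1, so the gᵢ are not in the kernel, and for the chosen pairs every
-- other matrix mod p with the reduced trace and determinant is conjugate to a fixed h₀. After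
-- conjugating inside G both gᵢ reduce to h₀, so g₂g₁⁻¹ = I + pA with A ∈ 𝔤, and comparing traces
-- and determinants in g₂ = (I + pA)g₁ determines tr(Ah₀) and tr A mod p. For p = 2, 3 every A
-- with these traces generates M₂(𝔽ₚ) under conjugation and addition. These finite facts are
-- checked by exhaustive computation, the last one by a search that records its derivations.

module Submission where

open import Defs
open import Algebra.Bundles using (CommutativeSemiring)
open import Algebra.Structures.Biased using (isCommutativeSemiringˡ)
import Algebra.Solver.Ring.NaturalCoefficients.Default as NaturalSolver
open import Data.Bool using (T?)
open import Data.Empty using (⊥-elim)
open import Data.Fin using (toℕ; _≟_)
open import Data.Fin.Properties using (toℕ-fromℕ<; toℕ-injective; toℕ<n; all?; any?)
open import Data.List using (List; []; _∷_; _++_; map)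
open import Data.Maybe using (Maybe; just; nothing; _>>=_; is-just; to-witness-T; from-just)
open import Data.Nat as ℕ using (ℕ; zero; suc; NonZero)
import Data.Nat.Properties as ℕ
open import Algebra.Properties.CommutativeSemigroup ℕ.*-commutativeSemigroup using (xy∙z≈xz∙y)
open import Data.Nat.DivMod
  using (_%_; _/_; m%n<n; m<n⇒m%n≡m; %-distribˡ-+; %-distribˡ-*; [m+n]%n≡m%n; m%n%n≡m%n; m*n%n≡0;
         m∣n⇒o%n%m≡o%m; m%n*o≡m*o%[n*o]; m≡m%n+[m/n]*n)
open import Data.Nat.Divisibility using (_∣_; m∣m*n)
open import Data.Product using (∃; Σ; _×_; _,_)
open import Data.Sum using (_⊎_; inj₁; inj₂)
open import Relation.Binary.PropositionalEquality
  using (_≡_; _≢_; refl; sym; trans; cong; cong₂; subst; isEquivalence; module ≡-Reasoning)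
open import Relation.Nullary using (Dec; yes; no; map′; _×-dec_; _⊎-dec_; _→-dec_; ¬?)
open import Relation.Nullary.Decidable using (dec⇒maybe)

open ≡-Reasoning

module ZModProperties (n : ℕ) .{{_ : NonZero n}} where

  infixl 6 _+_ _-_
  infixl 7 _*_

  _+_ _*_ _-_ : ZMod n → ZMod n → ZMod n
  _+_ = _+ₙ_ n
  _*_ = _*ₙ_ n
  _-_ = _-ₙ_ n

  0# 1# : ZMod n
  0# = 0ₙ n
  1# = 1ₙ n

  toℕ-[] : ∀ a → toℕ ([ n ] a) ≡ a % n
  toℕ-[] a = toℕ-fromℕ< (m%n<n a n)

  []-toℕ : ∀ x → [ n ] (toℕ x) ≡ x
  []-toℕ x = toℕ-injective (trans (toℕ-[] (toℕ x)) (m<n⇒m%n≡m (toℕ<n x)))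

  []-cong-% : ∀ {a b} → a % n ≡ b % n → [ n ] a ≡ [ n ] b
  []-cong-% {a} {b} eq = toℕ-injective (trans (toℕ-[] a) (trans eq (sym (toℕ-[] b))))

  []-+ : ∀ a b → [ n ] (a ℕ.+ b) ≡ [ n ] a + [ n ] b
  []-+ a b = []-cong-% (begin
    (a ℕ.+ b) % n                            ≡⟨ %-distribˡ-+ a b n ⟩
    (a % n ℕ.+ b % n) % n                    ≡⟨ cong₂ (λ u v → (u ℕ.+ v) % n) (toℕ-[] a) (toℕ-[] b) ⟨
    (toℕ ([ n ] a) ℕ.+ toℕ ([ n ] b)) % n    ∎)

  []-* : ∀ a b → [ n ] (a ℕ.* b) ≡ [ n ] a * [ n ] b
  []-* a b = []-cong-% (begin
    (a ℕ.* b) % n                            ≡⟨ %-distribˡ-* a b n ⟩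
    (a % n ℕ.* (b % n)) % n                  ≡⟨ cong₂ (λ u v → (u ℕ.* v) % n) (toℕ-[] a) (toℕ-[] b) ⟨
    (toℕ ([ n ] a) ℕ.* toℕ ([ n ] b)) % n    ∎)

  +-assoc : ∀ x y z → x + y + z ≡ x + (y + z)
  +-assoc x y z = begin
    [ n ] (x′ ℕ.+ y′) + z          ≡⟨ cong ([ n ] (x′ ℕ.+ y′) +_) ([]-toℕ z) ⟨
    [ n ] (x′ ℕ.+ y′) + [ n ] z′   ≡⟨ []-+ (x′ ℕ.+ y′) z′ ⟨
    [ n ] (x′ ℕ.+ y′ ℕ.+ z′)       ≡⟨ cong [ n ]_ (ℕ.+-assoc x′ y′ z′) ⟩
    [ n ] (x′ ℕ.+ (y′ ℕ.+ z′))     ≡⟨ []-+ x′ (y′ ℕ.+ z′) ⟩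
    [ n ] x′ + (y + z)             ≡⟨ cong (_+ (y + z)) ([]-toℕ x) ⟩
    x + (y + z)                    ∎
    where x′ = toℕ x; y′ = toℕ y; z′ = toℕ z

  +-comm : ∀ x y → x + y ≡ y + x
  +-comm x y = cong [ n ]_ (ℕ.+-comm (toℕ x) (toℕ y))

  +-identityˡ : ∀ x → 0# + x ≡ x
  +-identityˡ x = begin
    0# + x               ≡⟨ cong (0# +_) ([]-toℕ x) ⟨
    [ n ] 0 + [ n ] x′   ≡⟨ []-+ 0 x′ ⟨
    [ n ] x′             ≡⟨ []-toℕ x ⟩
    x                    ∎
    where x′ = toℕ x

  *-assoc : ∀ x y z → x * y * z ≡ x * (y * z)
  *-assoc x y z = begin
    [ n ] (x′ ℕ.* y′) * z          ≡⟨ cong ([ n ] (x′ ℕ.* y′) *_) ([]-toℕ z) ⟨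
    [ n ] (x′ ℕ.* y′) * [ n ] z′   ≡⟨ []-* (x′ ℕ.* y′) z′ ⟨
    [ n ] (x′ ℕ.* y′ ℕ.* z′)       ≡⟨ cong [ n ]_ (ℕ.*-assoc x′ y′ z′) ⟩
    [ n ] (x′ ℕ.* (y′ ℕ.* z′))     ≡⟨ []-* x′ (y′ ℕ.* z′) ⟩
    [ n ] x′ * (y * z)             ≡⟨ cong (_* (y * z)) ([]-toℕ x) ⟩
    x * (y * z)                    ∎
    where x′ = toℕ x; y′ = toℕ y; z′ = toℕ z

  *-comm : ∀ x y → x * y ≡ y * x
  *-comm x y = cong [ n ]_ (ℕ.*-comm (toℕ x) (toℕ y))

  *-identityˡ : ∀ x → 1# * x ≡ x
  *-identityˡ x = begin
    1# * x               ≡⟨ cong (1# *_) ([]-toℕ x) ⟨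
    [ n ] 1 * [ n ] x′   ≡⟨ []-* 1 x′ ⟨
    [ n ] (1 ℕ.* x′)     ≡⟨ cong [ n ]_ (ℕ.*-identityˡ x′) ⟩
    [ n ] x′             ≡⟨ []-toℕ x ⟩
    x                    ∎
    where x′ = toℕ x

  *-distribʳ-+ : ∀ x y z → (y + z) * x ≡ y * x + z * x
  *-distribʳ-+ x y z = begin
    [ n ] (y′ ℕ.+ z′) * x                  ≡⟨ cong ([ n ] (y′ ℕ.+ z′) *_) ([]-toℕ x) ⟨
    [ n ] (y′ ℕ.+ z′) * [ n ] x′           ≡⟨ []-* (y′ ℕ.+ z′) x′ ⟨
    [ n ] ((y′ ℕ.+ z′) ℕ.* x′)             ≡⟨ cong [ n ]_ (ℕ.*-distribʳ-+ x′ y′ z′) ⟩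
    [ n ] (y′ ℕ.* x′ ℕ.+ z′ ℕ.* x′)        ≡⟨ []-+ (y′ ℕ.* x′) (z′ ℕ.* x′) ⟩
    y * x + z * x                          ∎
    where x′ = toℕ x; y′ = toℕ y; z′ = toℕ z

  *-zeroˡ : ∀ x → 0# * x ≡ 0#
  *-zeroˡ x = begin
    0# * x               ≡⟨ cong (0# *_) ([]-toℕ x) ⟨
    [ n ] 0 * [ n ] x′   ≡⟨ []-* 0 x′ ⟨
    0#                   ∎
    where x′ = toℕ x

  +-identityʳ : ∀ x → x + 0# ≡ x
  +-identityʳ x = trans (+-comm x 0#) (+-identityˡ x)

  *-identityʳ : ∀ x → x * 1# ≡ x
  *-identityʳ x = trans (*-comm x 1#) (*-identityˡ x)

  *-zeroʳ : ∀ x → x * 0# ≡ 0#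
  *-zeroʳ x = trans (*-comm x 0#) (*-zeroˡ x)

  +-*-commutativeSemiring : CommutativeSemiring _ _
  +-*-commutativeSemiring = record
    { isCommutativeSemiring = isCommutativeSemiringˡ record
      { +-isCommutativeMonoid = record
        { isMonoid = record
          { isSemigroup = record { isMagma = record { isEquivalence = isEquivalence ; ∙-cong = cong₂ _+_ } ; assoc = +-assoc }
          ; identity = +-identityˡ , +-identityʳ }
        ; comm = +-comm }
      ; *-isCommutativeMonoid = record
        { isMonoid = record
          { isSemigroup = record { isMagma = record { isEquivalence = isEquivalence ; ∙-cong = cong₂ _*_ } ; assoc = *-assoc }
          ; identity = *-identityˡ , *-identityʳ }
        ; comm = *-comm }
      ; distribʳ = *-distribʳ-+
      ; zeroˡ = *-zeroˡ } }

  x-y+y≡x : ∀ x y → x - y + y ≡ x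
  x-y+y≡x x y = begin
    x - y + y                              ≡⟨ cong (x - y +_) ([]-toℕ y) ⟨
    [ n ] (x′ ℕ.+ (n ℕ.∸ y′)) + [ n ] y′   ≡⟨ []-+ (x′ ℕ.+ (n ℕ.∸ y′)) y′ ⟨
    [ n ] (x′ ℕ.+ (n ℕ.∸ y′) ℕ.+ y′)       ≡⟨ cong [ n ]_ (ℕ.+-assoc x′ (n ℕ.∸ y′) y′) ⟩
    [ n ] (x′ ℕ.+ (n ℕ.∸ y′ ℕ.+ y′))       ≡⟨ cong (λ k → [ n ] (x′ ℕ.+ k)) (ℕ.m∸n+n≡m (ℕ.<⇒≤ (toℕ<n y))) ⟩
    [ n ] (x′ ℕ.+ n)                       ≡⟨ []-cong-% ([m+n]%n≡m%n x′ n) ⟩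
    [ n ] x′                               ≡⟨ []-toℕ x ⟩
    x                                      ∎
    where x′ = toℕ x; y′ = toℕ y

  +-cancelʳ : ∀ x y z → x + z ≡ y + z → x ≡ y
  +-cancelʳ x y z eq = begin
    x                   ≡⟨ undo x ⟨
    x + z + (0# - z)    ≡⟨ cong (_+ (0# - z)) eq ⟩
    y + z + (0# - z)    ≡⟨ undo y ⟩
    y                   ∎
    where
    undo : ∀ w → w + z + (0# - z) ≡ w
    undo w = begin
      w + z + (0# - z)    ≡⟨ +-assoc w z (0# - z) ⟩
      w + (z + (0# - z))  ≡⟨ cong (w +_) (+-comm z (0# - z)) ⟩
      w + (0# - z + z)    ≡⟨ cong (w +_) (x-y+y≡x 0# z) ⟩
      w + 0#              ≡⟨ +-identityʳ w ⟩
      w                   ∎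

  x+z≡y⇒x≡y-z : ∀ x y z → x + z ≡ y → x ≡ y - z
  x+z≡y⇒x≡y-z x y z eq = +-cancelʳ x (y - z) z (trans eq (sym (x-y+y≡x y z)))

  x+w≡z+y⇒x-y≡z-w : ∀ x y z w → x + w ≡ z + y → x - y ≡ z - w
  x+w≡z+y⇒x-y≡z-w x y z w eq = +-cancelʳ (x - y) (z - w) (y + w) (begin
    x - y + (y + w)    ≡⟨ +-assoc (x - y) y w ⟨
    x - y + y + w      ≡⟨ cong (_+ w) (x-y+y≡x x y) ⟩
    x + w              ≡⟨ eq ⟩
    z + y              ≡⟨ cong (_+ y) (x-y+y≡x z w) ⟨
    z - w + w + y      ≡⟨ +-assoc (z - w) w y ⟩
    z - w + (w + y)    ≡⟨ cong (z - w +_) (+-comm w y) ⟩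
    z - w + (y + w)    ∎)

  x-0≡x : ∀ x → x - 0# ≡ x
  x-0≡x x = sym (x+z≡y⇒x≡y-z x x 0# (+-identityʳ x))

  open NaturalSolver +-*-commutativeSemiring using (solve; _:=_; _:+_; _:*_)

  -- Substituting u = U + v and s = S + w, where U = u - v and S = s - w, leaves a semiring identity.
  [u-v]*[s-w]≡us+vw-[uw+vs] : ∀ u v s w → (u - v) * (s - w) ≡ (u * s + v * w) - (u * w + v * s)
  [u-v]*[s-w]≡us+vw-[uw+vs] u v s w = x+z≡y⇒x≡y-z ((u - v) * (s - w)) (u * s + v * w) (u * w + v * s) (begin
    U * S + (u * w + v * s)                  ≡⟨ cong₂ (λ u s → U * S + (u * w + v * s)) (x-y+y≡x u v) (x-y+y≡x s w) ⟨
    U * S + ((U + v) * w + v * (S + w))      ≡⟨ expand U v S w ⟩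
    (U + v) * (S + w) + v * w                ≡⟨ cong₂ (λ u s → u * s + v * w) (x-y+y≡x u v) (x-y+y≡x s w) ⟩
    u * s + v * w                            ∎)
    where
    U = u - v
    S = s - w
    expand : ∀ U v S w → U * S + ((U + v) * w + v * (S + w)) ≡ (U + v) * (S + w) + v * w
    expand = solve 4 (λ U v S w → U :* S :+ ((U :+ v) :* w :+ v :* (S :+ w)) := (U :+ v) :* (S :+ w) :+ v :* w) refl

module MatrixProperties (n : ℕ) .{{_ : NonZero n}} where

  open ZModProperties n
  open NaturalSolver +-*-commutativeSemiring using (solve; _:=_; _:+_; _:*_; con)

  infixl 7 _∙_
  infixl 6 _⊕_

  _∙_ : Mat n → Mat n → Mat n
  _∙_ = _·_ n

  _⊕_ : Mat n → Mat n → Mat n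
  mat a b c d ⊕ mat a′ b′ c′ d′ = mat (a + a′) (b + b′) (c + c′) (d + d′)

  𝟙 𝟘 : Mat n
  𝟙 = I₂ n
  𝟘 = mat 0# 0# 0# 0#

  mat-cong : ∀ {a b c d a′ b′ c′ d′} → a ≡ a′ → b ≡ b′ → c ≡ c′ → d ≡ d′ →
             mat a b c d ≡ mat a′ b′ c′ d′
  mat-cong refl refl refl refl = refl

  ⊕-assoc : ∀ A B C → A ⊕ B ⊕ C ≡ A ⊕ (B ⊕ C)
  ⊕-assoc (mat a b c d) (mat e f g h) (mat i j k l) =
    mat-cong (+-assoc a e i) (+-assoc b f j) (+-assoc c g k) (+-assoc d h l)

  ⊕-comm : ∀ A B → A ⊕ B ≡ B ⊕ A
  ⊕-comm (mat a b c d) (mat e f g h) = mat-cong (+-comm a e) (+-comm b f) (+-comm c g) (+-comm d h)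

  ⊕-identityʳ : ∀ A → A ⊕ 𝟘 ≡ A
  ⊕-identityʳ (mat a b c d) = mat-cong (+-identityʳ a) (+-identityʳ b) (+-identityʳ c) (+-identityʳ d)

  ∙-assoc : ∀ A B C → A ∙ B ∙ C ≡ A ∙ (B ∙ C)
  ∙-assoc (mat a b c d) (mat e f g h) (mat i j k l) =
    mat-cong (entry a b e g f h i k) (entry a b e g f h j l) (entry c d e g f h i k) (entry c d e g f h j l)
    where
    entry : ∀ a b e g f h i k → (a * e + b * g) * i + (a * f + b * h) * k ≡ a * (e * i + f * k) + b * (g * i + h * k)
    entry = solve 8 (λ a b e g f h i k →
      (a :* e :+ b :* g) :* i :+ (a :* f :+ b :* h) :* k := a :* (e :* i :+ f :* k) :+ b :* (g :* i :+ h :* k)) refl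

  ∙-identityˡ : ∀ A → 𝟙 ∙ A ≡ A
  ∙-identityˡ (mat a b c d) = mat-cong (entry a c) (entry b d) (entry′ a c) (entry′ b d)
    where
    entry : ∀ x y → 1# * x + 0# * y ≡ x
    entry x y = trans (cong₂ _+_ (*-identityˡ x) (*-zeroˡ y)) (+-identityʳ x)
    entry′ : ∀ x y → 0# * x + 1# * y ≡ y
    entry′ x y = trans (cong₂ _+_ (*-zeroˡ x) (*-identityˡ y)) (+-identityˡ y)

  ∙-identityʳ : ∀ A → A ∙ 𝟙 ≡ A
  ∙-identityʳ (mat a b c d) = mat-cong (entry a b) (entry′ a b) (entry c d) (entry′ c d)
    where
    entry : ∀ x y → x * 1# + y * 0# ≡ x
    entry x y = trans (cong₂ _+_ (*-identityʳ x) (*-zeroʳ y)) (+-identityʳ x)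
    entry′ : ∀ x y → x * 0# + y * 1# ≡ y
    entry′ x y = trans (cong₂ _+_ (*-zeroʳ x) (*-identityʳ y)) (+-identityˡ y)

  ∙-distribˡ-⊕ : ∀ A B C → A ∙ (B ⊕ C) ≡ A ∙ B ⊕ A ∙ C
  ∙-distribˡ-⊕ (mat a b c d) (mat e f g h) (mat i j k l) =
    mat-cong (entry a b e g i k) (entry a b f h j l) (entry c d e g i k) (entry c d f h j l)
    where
    entry : ∀ a b e g i k → a * (e + i) + b * (g + k) ≡ a * e + b * g + (a * i + b * k)
    entry = solve 6 (λ a b e g i k → a :* (e :+ i) :+ b :* (g :+ k) := a :* e :+ b :* g :+ (a :* i :+ b :* k)) refl

  ∙-distribʳ-⊕ : ∀ A B C → (B ⊕ C) ∙ A ≡ B ∙ A ⊕ C ∙ A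
  ∙-distribʳ-⊕ (mat a b c d) (mat e f g h) (mat i j k l) =
    mat-cong (entry a c e f i j) (entry b d e f i j) (entry a c g h k l) (entry b d g h k l)
    where
    entry : ∀ a c e f i j → (e + i) * a + (f + j) * c ≡ e * a + f * c + (i * a + j * c)
    entry = solve 6 (λ a c e f i j → (e :+ i) :* a :+ (f :+ j) :* c := e :* a :+ f :* c :+ (i :* a :+ j :* c)) refl

  tr-⊕ : ∀ A B → tr n (A ⊕ B) ≡ tr n A + tr n B
  tr-⊕ (mat a b c d) (mat e f g h) = solve 4 (λ a d e h → a :+ e :+ (d :+ h) := a :+ d :+ (e :+ h)) refl a d e h

  tr-∙-comm : ∀ A B → tr n (A ∙ B) ≡ tr n (B ∙ A)
  tr-∙-comm (mat a b c d) (mat e f g h) = solve 8 (λ a b c d e f g h →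
    a :* e :+ b :* g :+ (c :* f :+ d :* h) := e :* a :+ f :* c :+ (g :* b :+ h :* d)) refl a b c d e f g h

  det-∙ : ∀ A B → det n (A ∙ B) ≡ det n A * det n B
  det-∙ (mat a b c d) (mat e f g h) = begin
    (a * e + b * g) * (c * f + d * h) - (a * f + b * h) * (c * e + d * g)
      ≡⟨ x+w≡z+y⇒x-y≡z-w ((a * e + b * g) * (c * f + d * h)) ((a * f + b * h) * (c * e + d * g))
                            (a * d * (e * h) + b * c * (f * g)) (a * d * (f * g) + b * c * (e * h)) (cauchy-binet a b c d e f g h) ⟩
    (a * d * (e * h) + b * c * (f * g)) - (a * d * (f * g) + b * c * (e * h))
      ≡⟨ [u-v]*[s-w]≡us+vw-[uw+vs] (a * d) (b * c) (e * h) (f * g) ⟨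
    (a * d - b * c) * (e * h - f * g) ∎
    where
    -- det (A ∙ B) = det A * det B with the subtracted terms moved across: a semiring identity.
    cauchy-binet : ∀ a b c d e f g h →
      (a * e + b * g) * (c * f + d * h) + (a * d * (f * g) + b * c * (e * h)) ≡
      (a * d * (e * h) + b * c * (f * g)) + (a * f + b * h) * (c * e + d * g)
    cauchy-binet = solve 8 (λ a b c d e f g h →
      (a :* e :+ b :* g) :* (c :* f :+ d :* h) :+ (a :* d :* (f :* g) :+ b :* c :* (e :* h)) :=
      (a :* d :* (e :* h) :+ b :* c :* (f :* g)) :+ (a :* f :+ b :* h) :* (c :* e :+ d :* g)) refl

  det-∙-comm : ∀ A B → det n (A ∙ B) ≡ det n (B ∙ A)
  det-∙-comm A B = trans (det-∙ A B) (trans (*-comm (det n A) (det n B)) (sym (det-∙ B A)))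

  det-𝟙 : det n 𝟙 ≡ 1#
  det-𝟙 = begin
    1# * 1# - 0# * 0#   ≡⟨ cong₂ _-_ (*-identityˡ 1#) (*-zeroˡ 0#) ⟩
    1# - 0#             ≡⟨ x-0≡x 1# ⟩
    1#                  ∎

  ∙-inverse⇒InGL₂ : ∀ A B → A ∙ B ≡ 𝟙 → InGL₂ n A
  ∙-inverse⇒InGL₂ A B AB≡𝟙 = det n B , trans (sym (det-∙ A B)) (trans (cong (det n) AB≡𝟙) det-𝟙)

  -- C = x⁻¹ B x for some invertible x, phrased without inverses.
  Similar : Mat n → Mat n → Set
  Similar B C = ∃ λ x → InGL₂ n x × B ∙ x ≡ x ∙ C

  similar-conj : ∀ x y B → x ∙ y ≡ 𝟙 → Similar B (y ∙ (B ∙ x))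
  similar-conj x y B xy≡𝟙 = x , ∙-inverse⇒InGL₂ x y xy≡𝟙 , (begin
    B ∙ x                ≡⟨ ∙-identityˡ (B ∙ x) ⟨
    𝟙 ∙ (B ∙ x)          ≡⟨ cong (_∙ (B ∙ x)) xy≡𝟙 ⟨
    x ∙ y ∙ (B ∙ x)      ≡⟨ ∙-assoc x y (B ∙ x) ⟩
    x ∙ (y ∙ (B ∙ x))    ∎)

  intertwined : ∀ y x B C → y ∙ x ≡ 𝟙 → B ∙ x ≡ x ∙ C → y ∙ (B ∙ x) ≡ C
  intertwined y x B C yx≡𝟙 Bx≡xC = begin
    y ∙ (B ∙ x)      ≡⟨ cong (y ∙_) Bx≡xC ⟩
    y ∙ (x ∙ C)      ≡⟨ ∙-assoc y x C ⟨
    y ∙ x ∙ C        ≡⟨ cong (_∙ C) yx≡𝟙 ⟩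
    𝟙 ∙ C            ≡⟨ ∙-identityˡ C ⟩
    C                ∎

  conj-invariant : (f : Mat n → ZMod n) → (∀ A B → f (A ∙ B) ≡ f (B ∙ A)) →
                   ∀ g X Y → X ∙ Y ≡ 𝟙 → f (Y ∙ (g ∙ X)) ≡ f g
  conj-invariant f f-comm g X Y XY≡𝟙 = begin
    f (Y ∙ (g ∙ X))     ≡⟨ f-comm Y (g ∙ X) ⟩
    f (g ∙ X ∙ Y)       ≡⟨ cong f (∙-assoc g X Y) ⟩
    f (g ∙ (X ∙ Y))     ≡⟨ cong (λ Z → f (g ∙ Z)) XY≡𝟙 ⟩
    f (g ∙ 𝟙)           ≡⟨ cong f (∙-identityʳ g) ⟩
    f g                 ∎

  infixr 8 _⋆_ _×ᴹ_

  _⋆_ : ZMod n → Mat n → Mat n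
  c ⋆ mat a b c′ d = mat (c * a) (c * b) (c * c′) (c * d)

  _×ᴹ_ : ℕ → Mat n → Mat n
  zero  ×ᴹ B = 𝟘
  suc k ×ᴹ B = B ⊕ k ×ᴹ B

  ×ᴹ≡[]⋆ : ∀ k B → k ×ᴹ B ≡ [ n ] k ⋆ B
  ×ᴹ≡[]⋆ zero    (mat a b c d) = sym (mat-cong (*-zeroˡ a) (*-zeroˡ b) (*-zeroˡ c) (*-zeroˡ d))
  ×ᴹ≡[]⋆ (suc k) B@(mat a b c d) = begin
    B ⊕ k ×ᴹ B             ≡⟨ cong (B ⊕_) (×ᴹ≡[]⋆ k B) ⟩
    B ⊕ [ n ] k ⋆ B        ≡⟨ mat-cong (entry a) (entry b) (entry c) (entry d) ⟩
    [ n ] (suc k) ⋆ B      ∎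
    where
    entry : ∀ x → x + [ n ] k * x ≡ [ n ] (suc k) * x
    entry x = begin
      x + [ n ] k * x               ≡⟨ cong (_+ [ n ] k * x) (*-identityˡ x) ⟨
      1# * x + [ n ] k * x          ≡⟨ *-distribʳ-+ x 1# ([ n ] k) ⟨
      (1# + [ n ] k) * x            ≡⟨ cong (_* x) ([]-+ 1 k) ⟨
      [ n ] (suc k) * x             ∎

  E₁₁ E₁₂ E₂₁ E₂₂ : Mat n
  E₁₁ = mat 1# 0# 0# 0#
  E₁₂ = mat 0# 1# 0# 0#
  E₂₁ = mat 0# 0# 1# 0#
  E₂₂ = mat 0# 0# 0# 1#

  mat≡ΣE : ∀ a b c d → mat a b c d ≡ a ⋆ E₁₁ ⊕ b ⋆ E₁₂ ⊕ c ⋆ E₂₁ ⊕ d ⋆ E₂₂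
  mat≡ΣE a b c d = mat-cong (solve 4 (λ a b c d → a := a :* con 1 :+ b :* con 0 :+ c :* con 0 :+ d :* con 0) refl a b c d)
                            (solve 4 (λ a b c d → b := a :* con 0 :+ b :* con 1 :+ c :* con 0 :+ d :* con 0) refl a b c d)
                            (solve 4 (λ a b c d → c := a :* con 0 :+ b :* con 0 :+ c :* con 1 :+ d :* con 0) refl a b c d)
                            (solve 4 (λ a b c d → d := a :* con 0 :+ b :* con 0 :+ c :* con 0 :+ d :* con 1) refl a b c d)

  data Generated (A : Mat n) : Mat n → Set where
    base : Generated A A
    zero : Generated A 𝟘
    add  : ∀ {B C} → Generated A B → Generated A C → Generated A (B ⊕ C)
    conj : ∀ {B C} → Similar B C → Generated A B → Generated A C

  generated-×ᴹ : ∀ {A B} k → Generated A B → Generated A (k ×ᴹ B)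
  generated-×ᴹ zero    _  = zero
  generated-×ᴹ (suc k) gB = add gB (generated-×ᴹ k gB)

  generated-⋆ : ∀ {A B} c → Generated A B → Generated A (c ⋆ B)
  generated-⋆ {B = B} c gB =
    subst (Generated _) (trans (×ᴹ≡[]⋆ (toℕ c) B) (cong (_⋆ B) ([]-toℕ c))) (generated-×ᴹ (toℕ c) gB)

  generated-all : ∀ {A} → Generated A E₁₁ → Generated A E₁₂ → Generated A E₂₁ → Generated A E₂₂ →
                  ∀ B → Generated A B
  generated-all g₁₁ g₁₂ g₂₁ g₂₂ (mat a b c d) = subst (Generated _) (sym (mat≡ΣE a b c d))
    (add (add (add (generated-⋆ a g₁₁) (generated-⋆ b g₁₂)) (generated-⋆ c g₂₁)) (generated-⋆ d g₂₂))

  infix 4 _≟ᴹ_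
  _≟ᴹ_ : (A B : Mat n) → Dec (A ≡ B)
  mat a b c d ≟ᴹ mat a′ b′ c′ d′ =
    map′ (λ (a≡ , b≡ , c≡ , d≡) → mat-cong a≡ b≡ c≡ d≡) (λ { refl → refl , refl , refl , refl })
         (a ≟ a′ ×-dec b ≟ b′ ×-dec c ≟ c′ ×-dec d ≟ d′)

  all-mat? : ∀ {P : Mat n → Set} → (∀ A → Dec (P A)) → Dec (∀ A → P A)
  all-mat? P? = map′ (λ ∀P → λ { (mat a b c d) → ∀P a b c d }) (λ ∀P a b c d → ∀P (mat a b c d))
                     (all? λ a → all? λ b → all? λ c → all? λ d → P? (mat a b c d))

  any-mat? : ∀ {P : Mat n → Set} → (∀ A → Dec (P A)) → Dec (∃ P)
  any-mat? P? = map′ (λ (a , b , c , d , PA) → mat a b c d , PA) (λ { (mat a b c d , PA) → a , b , c , d , PA })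
                     (any? λ a → any? λ b → any? λ c → any? λ d → P? (mat a b c d))

  isUnit? : ∀ x → Dec (IsUnit n x)
  isUnit? x = any? λ y → x * y ≟ 1#

  similar? : ∀ B C → Dec (Similar B C)
  similar? B C = any-mat? λ x → isUnit? (det n x) ×-dec B ∙ x ≟ᴹ x ∙ C

module SpanSearch (n : ℕ) .{{_ : NonZero n}} where

  open ZModProperties n
  open MatrixProperties n

  Conjugator : Set
  Conjugator = Σ (Mat n × Mat n) λ (x , y) → x ∙ y ≡ 𝟙

  module _ (A : Mat n) where

    Derived : Set
    Derived = ∃ (Generated A)

    find : List Derived → ∀ B → Maybe (Generated A B)
    find []             B = nothing
    find ((C , gC) ∷ Δ) B with C ≟ᴹ B
    ... | yes refl = just gC
    ... | no  _    = find Δ B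

    shift : Derived → List Derived → List Derived
    shift (B , gB) = map λ (C , gC) → C ⊕ B , add gC gB

    extend : ℕ → Derived → List Derived → List Derived
    extend zero    _ Δ = Δ
    extend (suc k) b Δ = Δ ++ extend k b (shift b Δ)

    conjugates : List Conjugator → Derived → List Derived
    conjugates xs (B , gB) = map (λ ((x , y) , xy≡𝟙) → y ∙ (B ∙ x) , conj (similar-conj x y B xy≡𝟙) gB) xs

    -- `span` is the additive subgroup generated by the elements taken from the queue so far
    -- (`extend (n - 1)` adds all multiples of a new one), and conjugates of new elements are
    -- queued. Every element carries its derivation, so the search only has to succeed.
    saturate : ℕ → List Conjugator → List Derived → List Derived → List Derived
    saturate zero       _  _                 span = span
    saturate (suc fuel) _  []                span = span
    saturate (suc fuel) xs (b@(B , _) ∷ queue) span with find span B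
    ... | just _  = saturate fuel xs queue span
    ... | nothing = saturate fuel xs (queue ++ conjugates xs b) (extend (ℕ.pred n) b span)

    generates-all? : ℕ → List Conjugator → Maybe (∀ B → Generated A B)
    generates-all? fuel xs = do
      g₁₁ ← find span E₁₁
      g₁₂ ← find span E₁₂
      g₂₁ ← find span E₂₁
      g₂₂ ← find span E₂₂
      just (generated-all g₁₁ g₁₂ g₂₁ g₂₂)
      where
      span : List Derived
      span = saturate fuel xs ((A , base) ∷ []) ((𝟘 , zero) ∷ [])

module Reduction (m n : ℕ) .{{_ : NonZero m}} .{{_ : NonZero n}} (n∣m : n ∣ m) where

  private
    module M = ZModProperties m
    module N = ZModProperties n
    module Mᴹ = MatrixProperties m
    module Nᴹ = MatrixProperties n

  red-[] : ∀ a → red m n ([ m ] a) ≡ [ n ] a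
  red-[] a = N.[]-cong-% (trans (cong (_% n) (M.toℕ-[] a)) (m∣n⇒o%n%m≡o%m n m a n∣m))

  red-+ : ∀ x y → red m n (x M.+ y) ≡ red m n x N.+ red m n y
  red-+ x y = trans (red-[] (toℕ x ℕ.+ toℕ y)) (N.[]-+ (toℕ x) (toℕ y))

  red-* : ∀ x y → red m n (x M.* y) ≡ red m n x N.* red m n y
  red-* x y = trans (red-[] (toℕ x ℕ.* toℕ y)) (N.[]-* (toℕ x) (toℕ y))

  red-minus : ∀ x y → red m n (x M.- y) ≡ red m n x N.- red m n y
  red-minus x y = N.x+z≡y⇒x≡y-z (red m n (x M.- y)) (red m n x) (red m n y)
    (trans (sym (red-+ (x M.- y) y)) (cong (red m n) (M.x-y+y≡x x y)))

  redMat-⊕ : ∀ A B → redMat m n (A Mᴹ.⊕ B) ≡ redMat m n A Nᴹ.⊕ redMat m n B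
  redMat-⊕ (mat a b c d) (mat e f g h) = Nᴹ.mat-cong (red-+ a e) (red-+ b f) (red-+ c g) (red-+ d h)

  redMat-∙ : ∀ A B → redMat m n (A Mᴹ.∙ B) ≡ redMat m n A Nᴹ.∙ redMat m n B
  redMat-∙ (mat a b c d) (mat e f g h) = Nᴹ.mat-cong (entry a e b g) (entry a f b h) (entry c e d g) (entry c f d h)
    where
    entry : ∀ a e b g → red m n (a M.* e M.+ b M.* g) ≡ red m n a N.* red m n e N.+ red m n b N.* red m n g
    entry a e b g = trans (red-+ (a M.* e) (b M.* g)) (cong₂ N._+_ (red-* a e) (red-* b g))

  redMat-𝟙 : redMat m n Mᴹ.𝟙 ≡ Nᴹ.𝟙
  redMat-𝟙 = Nᴹ.mat-cong (red-[] 1) (red-[] 0) (red-[] 0) (red-[] 1)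

  redMat-inverse : ∀ Y X → Y Mᴹ.∙ X ≡ Mᴹ.𝟙 → redMat m n Y Nᴹ.∙ redMat m n X ≡ Nᴹ.𝟙
  redMat-inverse Y X YX≡𝟙 = trans (sym (redMat-∙ Y X)) (trans (cong (redMat m n) YX≡𝟙) redMat-𝟙)

  red-tr : ∀ A → red m n (tr m A) ≡ tr n (redMat m n A)
  red-tr (mat a b c d) = red-+ a d

  red-det : ∀ A → red m n (det m A) ≡ det n (redMat m n A)
  red-det (mat a b c d) = trans (red-minus (a M.* d) (b M.* c)) (cong₂ N._-_ (red-* a d) (red-* b c))

  redMat-InGL₂ : ∀ A → InGL₂ m A → InGL₂ n (redMat m n A)
  redMat-InGL₂ A (u , du≡1) = red m n u , (begin
    det n (redMat m n A) N.* red m n u   ≡⟨ cong (N._* red m n u) (red-det A) ⟨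
    red m n (det m A) N.* red m n u      ≡⟨ red-* (det m A) u ⟨
    red m n (det m A M.* u)              ≡⟨ cong (red m n) du≡1 ⟩
    red m n M.1#                         ≡⟨ red-[] 1 ⟩
    N.1#                                 ∎)

-- For p = 1 both sides are the only element of ℤ/1ℤ.
[p*p]1%p≡1 : ∀ p .{{_ : NonZero p}} .{{_ : NonZero (p ℕ.* p)}} → [ p ℕ.* p ] (1 % p) ≡ 1ₙ (p ℕ.* p)
[p*p]1%p≡1 (suc zero)    = refl
[p*p]1%p≡1 (suc (suc _)) = refl

module Kernel (p : ℕ) .{{_ : NonZero p}} where

  p² : ℕ
  p² = p ℕ.* p

  instance
    p²-nonZero : NonZero p²
    p²-nonZero = ℕ.m*n≢0 p p

  open ZModProperties p²
  open MatrixProperties p²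
  open Reduction p² p (m∣m*n p)
  private
    module P = ZModProperties p
    module Pᴹ = MatrixProperties p

  red′ : ZMod p² → ZMod p
  red′ = red p² p

  redMat′ : Mat p² → Mat p
  redMat′ = redMat p² p

  -- Multiplication by p, identifying 𝔽ₚ with the ideal pℤ/p²ℤ.
  ι : ZMod p → ZMod p²
  ι a = [ p² ] (toℕ a ℕ.* p)

  ι-[] : ∀ a → ι ([ p ] a) ≡ [ p² ] (a ℕ.* p)
  ι-[] a = []-cong-% (begin
    toℕ ([ p ] a) ℕ.* p % p²   ≡⟨ cong (λ k → k ℕ.* p % p²) (P.toℕ-[] a) ⟩
    a % p ℕ.* p % p²           ≡⟨ cong (_% p²) (m%n*o≡m*o%[n*o] a p p) ⟩
    a ℕ.* p % p² % p²          ≡⟨ m%n%n≡m%n (a ℕ.* p) p² ⟩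
    a ℕ.* p % p²               ∎)

  ι-+ : ∀ a b → ι (a P.+ b) ≡ ι a + ι b
  ι-+ a b = trans (ι-[] (toℕ a ℕ.+ toℕ b))
                  (trans (cong [ p² ]_ (ℕ.*-distribʳ-+ p (toℕ a) (toℕ b))) ([]-+ (toℕ a ℕ.* p) (toℕ b ℕ.* p)))

  ι-* : ∀ a x → ι a * x ≡ ι (a P.* red′ x)
  ι-* a x = begin
    ι a * x                           ≡⟨ cong (ι a *_) ([]-toℕ x) ⟨
    [ p² ] (a′ ℕ.* p) * [ p² ] x′     ≡⟨ []-* (a′ ℕ.* p) x′ ⟨
    [ p² ] (a′ ℕ.* p ℕ.* x′)          ≡⟨ cong [ p² ]_ (xy∙z≈xz∙y a′ p x′) ⟩
    [ p² ] (a′ ℕ.* x′ ℕ.* p)          ≡⟨ ι-[] (a′ ℕ.* x′) ⟨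
    ι ([ p ] (a′ ℕ.* x′))             ≡⟨ cong ι (P.[]-* a′ x′) ⟩
    ι ([ p ] a′ P.* red′ x)           ≡⟨ cong (λ b → ι (b P.* red′ x)) (P.[]-toℕ a) ⟩
    ι (a P.* red′ x)                  ∎
    where a′ = toℕ a; x′ = toℕ x

  red-ι : ∀ a → red′ (ι a) ≡ P.0#
  red-ι a = trans (red-[] (toℕ a ℕ.* p)) (P.[]-cong-% (trans (m*n%n≡0 (toℕ a) p) (sym (m*n%n≡0 0 p))))

  ι-0 : ι P.0# ≡ 0#
  ι-0 = ι-[] 0

  ι-*-ι : ∀ a b → ι a * ι b ≡ 0#
  ι-*-ι a b = begin
    ι a * ι b                ≡⟨ ι-* a (ι b) ⟩
    ι (a P.* red′ (ι b))     ≡⟨ cong (λ c → ι (a P.* c)) (red-ι b) ⟩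
    ι (a P.* P.0#)           ≡⟨ cong ι (P.*-zeroʳ a) ⟩
    ι P.0#                   ≡⟨ ι-0 ⟩
    0#                       ∎

  ιᴹ : Mat p → Mat p²
  ιᴹ (mat a b c d) = mat (ι a) (ι b) (ι c) (ι d)

  I+p : Mat p → Mat p²
  I+p A = 𝟙 ⊕ ιᴹ A

  ιᴹ-∙ : ∀ A X → ιᴹ A ∙ X ≡ ιᴹ (A Pᴹ.∙ redMat′ X)
  ιᴹ-∙ (mat a b c d) (mat e f g h) = mat-cong (entry a e b g) (entry a f b h) (entry c e d g) (entry c f d h)
    where
    entry : ∀ a e b g → ι a * e + ι b * g ≡ ι (a P.* red′ e P.+ b P.* red′ g)
    entry a e b g = trans (cong₂ _+_ (ι-* a e) (ι-* b g)) (sym (ι-+ (a P.* red′ e) (b P.* red′ g)))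

  ∙-ιᴹ : ∀ X A → X ∙ ιᴹ A ≡ ιᴹ (redMat′ X Pᴹ.∙ A)
  ∙-ιᴹ (mat a b c d) (mat e f g h) = mat-cong (entry a e b g) (entry a f b h) (entry c e d g) (entry c f d h)
    where
    entry : ∀ a e b g → a * ι e + b * ι g ≡ ι (red′ a P.* e P.+ red′ b P.* g)
    entry a e b g = begin
      a * ι e + b * ι g                          ≡⟨ cong₂ _+_ (*-comm a (ι e)) (*-comm b (ι g)) ⟩
      ι e * a + ι g * b                          ≡⟨ cong₂ _+_ (ι-* e a) (ι-* g b) ⟩
      ι (e P.* red′ a) + ι (g P.* red′ b)        ≡⟨ ι-+ (e P.* red′ a) (g P.* red′ b) ⟨
      ι (e P.* red′ a P.+ g P.* red′ b)          ≡⟨ cong ι (cong₂ P._+_ (P.*-comm e (red′ a)) (P.*-comm g (red′ b))) ⟩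
      ι (red′ a P.* e P.+ red′ b P.* g)          ∎

  ιᴹ-⊕ : ∀ A B → ιᴹ A ⊕ ιᴹ B ≡ ιᴹ (A Pᴹ.⊕ B)
  ιᴹ-⊕ (mat a b c d) (mat e f g h) = sym (mat-cong (ι-+ a e) (ι-+ b f) (ι-+ c g) (ι-+ d h))

  ιᴹ-𝟘 : ιᴹ Pᴹ.𝟘 ≡ 𝟘
  ιᴹ-𝟘 = mat-cong ι-0 ι-0 ι-0 ι-0

  redMat-ιᴹ : ∀ A → redMat′ (ιᴹ A) ≡ Pᴹ.𝟘
  redMat-ιᴹ (mat a b c d) = Pᴹ.mat-cong (red-ι a) (red-ι b) (red-ι c) (red-ι d)

  tr-ιᴹ : ∀ A → tr p² (ιᴹ A) ≡ ι (tr p A)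
  tr-ιᴹ (mat a b c d) = sym (ι-+ a d)

  redMat-I+p : ∀ A → redMat′ (I+p A) ≡ Pᴹ.𝟙
  redMat-I+p A = begin
    redMat′ (𝟙 ⊕ ιᴹ A)               ≡⟨ redMat-⊕ 𝟙 (ιᴹ A) ⟩
    redMat′ 𝟙 Pᴹ.⊕ redMat′ (ιᴹ A)     ≡⟨ cong₂ Pᴹ._⊕_ redMat-𝟙 (redMat-ιᴹ A) ⟩
    Pᴹ.𝟙 Pᴹ.⊕ Pᴹ.𝟘                   ≡⟨ Pᴹ.⊕-identityʳ Pᴹ.𝟙 ⟩
    Pᴹ.𝟙                             ∎

  I+p-𝟘 : I+p Pᴹ.𝟘 ≡ 𝟙
  I+p-𝟘 = trans (cong (𝟙 ⊕_) ιᴹ-𝟘) (⊕-identityʳ 𝟙)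

  I+p-∙ : ∀ A X → I+p A ∙ X ≡ X ⊕ ιᴹ (A Pᴹ.∙ redMat′ X)
  I+p-∙ A X = begin
    (𝟙 ⊕ ιᴹ A) ∙ X                   ≡⟨ ∙-distribʳ-⊕ X 𝟙 (ιᴹ A) ⟩
    𝟙 ∙ X ⊕ ιᴹ A ∙ X                 ≡⟨ cong₂ _⊕_ (∙-identityˡ X) (ιᴹ-∙ A X) ⟩
    X ⊕ ιᴹ (A Pᴹ.∙ redMat′ X)        ∎

  I+p-∙-I+p : ∀ A B → I+p A ∙ I+p B ≡ I+p (A Pᴹ.⊕ B)
  I+p-∙-I+p A B = begin
    I+p A ∙ I+p B                               ≡⟨ I+p-∙ A (I+p B) ⟩
    𝟙 ⊕ ιᴹ B ⊕ ιᴹ (A Pᴹ.∙ redMat′ (I+p B))      ≡⟨ cong (λ X → 𝟙 ⊕ ιᴹ B ⊕ ιᴹ (A Pᴹ.∙ X)) (redMat-I+p B) ⟩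
    𝟙 ⊕ ιᴹ B ⊕ ιᴹ (A Pᴹ.∙ Pᴹ.𝟙)                 ≡⟨ cong (λ X → 𝟙 ⊕ ιᴹ B ⊕ ιᴹ X) (Pᴹ.∙-identityʳ A) ⟩
    𝟙 ⊕ ιᴹ B ⊕ ιᴹ A                             ≡⟨ ⊕-assoc 𝟙 (ιᴹ B) (ιᴹ A) ⟩
    𝟙 ⊕ (ιᴹ B ⊕ ιᴹ A)                           ≡⟨ cong (𝟙 ⊕_) (trans (⊕-comm (ιᴹ B) (ιᴹ A)) (ιᴹ-⊕ A B)) ⟩
    I+p (A Pᴹ.⊕ B)                              ∎

  ∙-I+p-∙ : ∀ Y A X → Y ∙ X ≡ 𝟙 → Y ∙ (I+p A ∙ X) ≡ I+p (redMat′ Y Pᴹ.∙ (A Pᴹ.∙ redMat′ X))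
  ∙-I+p-∙ Y A X YX≡𝟙 = begin
    Y ∙ (I+p A ∙ X)                                   ≡⟨ cong (Y ∙_) (I+p-∙ A X) ⟩
    Y ∙ (X ⊕ ιᴹ (A Pᴹ.∙ redMat′ X))                   ≡⟨ ∙-distribˡ-⊕ Y X (ιᴹ (A Pᴹ.∙ redMat′ X)) ⟩
    Y ∙ X ⊕ Y ∙ ιᴹ (A Pᴹ.∙ redMat′ X)                 ≡⟨ cong₂ _⊕_ YX≡𝟙 (∙-ιᴹ Y (A Pᴹ.∙ redMat′ X)) ⟩
    I+p (redMat′ Y Pᴹ.∙ (A Pᴹ.∙ redMat′ X))           ∎

  tr-I+p-∙ : ∀ A X → tr p² (I+p A ∙ X) ≡ tr p² X + ι (tr p (A Pᴹ.∙ redMat′ X))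
  tr-I+p-∙ A X = trans (cong (tr p²) (I+p-∙ A X))
                       (trans (tr-⊕ X (ιᴹ (A Pᴹ.∙ redMat′ X))) (cong (tr p² X +_) (tr-ιᴹ (A Pᴹ.∙ redMat′ X))))

  det-I+p : ∀ A → det p² (I+p A) ≡ 1# + ι (tr p A)
  det-I+p (mat a b c d) = begin
    (1# + ι a) * (1# + ι d) - (0# + ι b) * (0# + ι c)   ≡⟨ cong₂ _-_ (expand (ι a) (ι d)) off-diagonal ⟩
    1# + (ι a + ι d) + ι a * ι d - 0#                   ≡⟨ x-0≡x _ ⟩
    1# + (ι a + ι d) + ι a * ι d                        ≡⟨ cong₂ (λ u v → 1# + u + v) (sym (ι-+ a d)) (ι-*-ι a d) ⟩
    1# + ι (a P.+ d) + 0#                               ≡⟨ +-identityʳ _ ⟩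
    1# + ι (a P.+ d)                                    ∎
    where
    open NaturalSolver +-*-commutativeSemiring using (solve; _:=_; _:+_; _:*_; con)
    expand : ∀ u v → (1# + u) * (1# + v) ≡ 1# + (u + v) + u * v
    expand = solve 2 (λ u v → (con 1 :+ u) :* (con 1 :+ v) := con 1 :+ (u :+ v) :+ u :* v) refl
    off-diagonal : (0# + ι b) * (0# + ι c) ≡ 0#
    off-diagonal = trans (cong₂ _*_ (+-identityˡ (ι b)) (+-identityˡ (ι c))) (ι-*-ι b c)

  tr-I+p : ∀ A → tr p² (I+p A) ≡ det p² (I+p A) + 1#
  tr-I+p A@(mat a b c d) = begin
    1# + ι a + (1# + ι d)      ≡⟨ regroup (ι a) (ι d) ⟩
    1# + (ι a + ι d) + 1#      ≡⟨ cong (λ u → 1# + u + 1#) (ι-+ a d) ⟨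
    1# + ι (tr p A) + 1#       ≡⟨ cong (_+ 1#) (det-I+p A) ⟨
    det p² (I+p A) + 1#        ∎
    where
    open NaturalSolver +-*-commutativeSemiring using (solve; _:=_; _:+_; con)
    regroup : ∀ u v → 1# + u + (1# + v) ≡ 1# + (u + v) + 1#
    regroup = solve 2 (λ u v → con 1 :+ u :+ (con 1 :+ v) := con 1 :+ (u :+ v) :+ con 1) refl

  det-I+p-∙ : ∀ A X → det p² (I+p A ∙ X) ≡ (1# + ι (tr p A)) * det p² X
  det-I+p-∙ A X = trans (det-∙ (I+p A) X) (cong (_* det p² X) (det-I+p A))

  quot : ZMod p² → ZMod p
  quot x = [ p ] (toℕ x / p)

  quotᴹ : Mat p² → Mat p
  quotᴹ (mat a b c d) = mat (quot a) (quot b) (quot c) (quot d)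

  red≡[c]⇒≡[c%p]+ι : ∀ x c → red′ x ≡ [ p ] c → x ≡ [ p² ] (c % p) + ι (quot x)
  red≡[c]⇒≡[c%p]+ι x c red≡c = begin
    x                                            ≡⟨ []-toℕ x ⟨
    [ p² ] x′                                    ≡⟨ cong [ p² ]_ (m≡m%n+[m/n]*n x′ p) ⟩
    [ p² ] (x′ % p ℕ.+ x′ / p ℕ.* p)             ≡⟨ []-+ (x′ % p) (x′ / p ℕ.* p) ⟩
    [ p² ] (x′ % p) + [ p² ] (x′ / p ℕ.* p)      ≡⟨ cong₂ (λ r q → [ p² ] r + q) x′%p≡c%p (sym (ι-[] (x′ / p))) ⟩
    [ p² ] (c % p) + ι (quot x)                  ∎
    where
    x′ = toℕ x
    x′%p≡c%p : x′ % p ≡ c % p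
    x′%p≡c%p = trans (sym (P.toℕ-[] x′)) (trans (cong toℕ red≡c) (P.toℕ-[] c))

  redMat≡𝟙⇒≡I+p : ∀ k → redMat′ k ≡ Pᴹ.𝟙 → k ≡ I+p (quotᴹ k)
  redMat≡𝟙⇒≡I+p (mat a b c d) red≡𝟙 =
    mat-cong (diagonal a (cong Mat.a red≡𝟙)) (off-diagonal b (cong Mat.b red≡𝟙))
             (off-diagonal c (cong Mat.c red≡𝟙)) (diagonal d (cong Mat.d red≡𝟙))
    where
    diagonal : ∀ x → red′ x ≡ P.1# → x ≡ 1# + ι (quot x)
    diagonal x eq = trans (red≡[c]⇒≡[c%p]+ι x 1 eq) (cong (_+ ι (quot x)) ([p*p]1%p≡1 p))
    off-diagonal : ∀ x → red′ x ≡ P.0# → x ≡ 0# + ι (quot x)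
    off-diagonal x eq = trans (red≡[c]⇒≡[c%p]+ι x 0 eq) (cong (λ r → [ p² ] r + ι (quot x)) (m*n%n≡0 0 p))

module Criterion (p : ℕ) .{{_ : NonZero p}} where

  open Kernel p
  open ZModProperties p²
  open MatrixProperties p²
  open Reduction p² p (m∣m*n p)
  private
    module Pᴹ = MatrixProperties p

  ReductionsSimilarTo : Mat p → ZMod p² → ZMod p² → Set
  ReductionsSimilarTo h₀ t d = ∀ h → tr p h ≡ red′ t → det p h ≡ red′ d → h ≡ Pᴹ.𝟙 ⊎ Pᴹ.Similar h h₀

  -- If g₁, g₂ ∈ G both reduce to h₀ and have (tr, det) = (tᵢ, dᵢ), then g₂ = (I + pA) g₁ where
  -- I + pA ∈ G and A satisfies the hypotheses of `generates`.
  record Certificate : Set where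
    field
      h₀          : Mat p
      t₁ d₁ t₂ d₂ : ZMod p²
      d₁-unit     : IsUnit p² d₁
      d₂-unit     : IsUnit p² d₂
      t₁≢d₁+1     : t₁ ≢ d₁ + 1#
      t₂≢d₂+1     : t₂ ≢ d₂ + 1#
      similar₁    : ReductionsSimilarTo h₀ t₁ d₁
      similar₂    : ReductionsSimilarTo h₀ t₂ d₂
      generates   : ∀ A → t₁ + ι (tr p (A Pᴹ.∙ h₀)) ≡ t₂ → (1# + ι (tr p A)) * d₁ ≡ d₂ →
                    ∀ B → Pᴹ.Generated A B

  certify : Mat p → (t₁ d₁ t₂ d₂ : ZMod p²) → ℕ → List (SpanSearch.Conjugator p) → Maybe Certificate
  certify h₀ t₁ d₁ t₂ d₂ fuel xs = do
    d₁-unit ← dec⇒maybe (isUnit? d₁)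
    d₂-unit ← dec⇒maybe (isUnit? d₂)
    t₁≢d₁+1 ← dec⇒maybe (¬? (t₁ ≟ d₁ + 1#))
    t₂≢d₂+1 ← dec⇒maybe (¬? (t₂ ≟ d₂ + 1#))
    similar₁ ← dec⇒maybe (reductionsSimilarTo? h₀ t₁ d₁)
    similar₂ ← dec⇒maybe (reductionsSimilarTo? h₀ t₂ d₂)
    found ← dec⇒maybe (Pᴹ.all-mat? λ A → t₁ + ι (tr p (A Pᴹ.∙ h₀)) ≟ t₂ →-dec
                                            (1# + ι (tr p A)) * d₁ ≟ d₂ →-dec
                                            T? (is-just (SpanSearch.generates-all? p A fuel xs)))
    just record
      { h₀ = h₀ ; t₁ = t₁ ; d₁ = d₁ ; t₂ = t₂ ; d₂ = d₂
      ; d₁-unit = d₁-unit ; d₂-unit = d₂-unit ; t₁≢d₁+1 = t₁≢d₁+1 ; t₂≢d₂+1 = t₂≢d₂+1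
      ; similar₁ = similar₁ ; similar₂ = similar₂
      ; generates = λ A tr≡ det≡ → to-witness-T (SpanSearch.generates-all? p A fuel xs) (found A tr≡ det≡) }
    where
    reductionsSimilarTo? : ∀ h₀ t d → Dec (ReductionsSimilarTo h₀ t d)
    reductionsSimilarTo? h₀ t d = Pᴹ.all-mat? λ h → tr p h ≟ red′ t →-dec det p h ≟ red′ d →-dec
                                                      (h Pᴹ.≟ᴹ Pᴹ.𝟙 ⊎-dec Pᴹ.similar? h h₀)

  module Subgroup (G : Mat p² → Set) (G-subgroup : IsSubgroupGL₂ p² G)
                  (G-onto : ∀ h → InGL₂ p h → ∃ λ g → G g × redMat′ g ≡ h) where

    open IsSubgroupGL₂ G-subgroup

    𝔤 : Mat p → Set
    𝔤 A = G (I+p A)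

    record Lift (x : Mat p) : Set where
      field
        X Y  : Mat p²
        X∈G  : G X
        Y∈G  : G Y
        X↦x  : redMat′ X ≡ x
        XY≡𝟙 : X ∙ Y ≡ 𝟙
        YX≡𝟙 : Y ∙ X ≡ 𝟙

      conjugates : ∀ B C → B Pᴹ.∙ x ≡ x Pᴹ.∙ C → redMat′ Y Pᴹ.∙ (B Pᴹ.∙ redMat′ X) ≡ C
      conjugates B C Bx≡xC = Pᴹ.intertwined (redMat′ Y) (redMat′ X) B C (redMat-inverse Y X YX≡𝟙)
                                            (subst (λ x → B Pᴹ.∙ x ≡ x Pᴹ.∙ C) (sym X↦x) Bx≡xC)

    lift : ∀ x → InGL₂ p x → Lift x
    lift x x-inv =
      let X , X∈G , X↦x = G-onto x x-inv
          Y , Y∈G , XY≡𝟙 , YX≡𝟙 = inv X X∈G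
      in record { X = X ; Y = Y ; X∈G = X∈G ; Y∈G = Y∈G ; X↦x = X↦x ; XY≡𝟙 = XY≡𝟙 ; YX≡𝟙 = YX≡𝟙 }

    𝔤-conj : ∀ B C → Pᴹ.Similar B C → 𝔤 B → 𝔤 C
    𝔤-conj B C (x , x-inv , Bx≡xC) 𝔤B =
      subst G (trans (∙-I+p-∙ Y B X YX≡𝟙) (cong I+p (conjugates B C Bx≡xC)))
              (closed Y (I+p B ∙ X) Y∈G (closed (I+p B) X 𝔤B X∈G))
      where open Lift (lift x x-inv)

    generated⊆𝔤 : ∀ {A B} → 𝔤 A → Pᴹ.Generated A B → 𝔤 B
    generated⊆𝔤 𝔤A Pᴹ.base                   = 𝔤A
    generated⊆𝔤 𝔤A Pᴹ.zero                   = subst G (sym I+p-𝟘) has-I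
    generated⊆𝔤 𝔤A (Pᴹ.add {B} {C} 𝔤B 𝔤C)    =
      subst G (I+p-∙-I+p B C) (closed (I+p B) (I+p C) (generated⊆𝔤 𝔤A 𝔤B) (generated⊆𝔤 𝔤A 𝔤C))
    generated⊆𝔤 𝔤A (Pᴹ.conj {B} {C} B∼C 𝔤B) = 𝔤-conj B C B∼C (generated⊆𝔤 𝔤A 𝔤B)

    𝔤-full⇒GL₂⊆G : (∀ A → 𝔤 A) → ∀ g → InGL₂ p² g → G g
    𝔤-full⇒GL₂⊆G 𝔤-full g g-inv =
      subst G X∙Y∙g≡g (closed X (Y ∙ g) X∈G (subst G (sym Y∙g≡I+p) (𝔤-full (quotᴹ (Y ∙ g)))))
      where
      open Lift (lift (redMat′ g) (redMat-InGL₂ g g-inv))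
      Y∙g≡I+p : Y ∙ g ≡ I+p (quotᴹ (Y ∙ g))
      Y∙g≡I+p = redMat≡𝟙⇒≡I+p (Y ∙ g) (begin
        redMat′ (Y ∙ g)                   ≡⟨ redMat-∙ Y g ⟩
        redMat′ Y Pᴹ.∙ redMat′ g          ≡⟨ cong (redMat′ Y Pᴹ.∙_) X↦x ⟨
        redMat′ Y Pᴹ.∙ redMat′ X          ≡⟨ redMat-inverse Y X YX≡𝟙 ⟩
        Pᴹ.𝟙                              ∎)
      X∙Y∙g≡g : X ∙ (Y ∙ g) ≡ g
      X∙Y∙g≡g = trans (sym (∙-assoc X Y g)) (trans (cong (_∙ g) XY≡𝟙) (∙-identityˡ g))

    RepresentativeOver : Mat p → ZMod p² → ZMod p² → Set
    RepresentativeOver h₀ t d = ∃ λ g → G g × redMat′ g ≡ h₀ × tr p² g ≡ t × det p² g ≡ d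

    representative-over : ∀ {h₀ t d} → t ≢ d + 1# → ReductionsSimilarTo h₀ t d → Represents p² G t d →
                          RepresentativeOver h₀ t d
    representative-over {h₀} {t} {d} t≢d+1 similar (g , g∈G , tr≡t , det≡d)
      with similar (redMat′ g) (trans (sym (red-tr g)) (cong red′ tr≡t)) (trans (sym (red-det g)) (cong red′ det≡d))
    ... | inj₁ g↦𝟙 = ⊥-elim (t≢d+1 (begin
      t                                     ≡⟨ tr≡t ⟨
      tr p² g                               ≡⟨ cong (tr p²) g≡I+p ⟩
      tr p² (I+p (quotᴹ g))                 ≡⟨ tr-I+p (quotᴹ g) ⟩
      det p² (I+p (quotᴹ g)) + 1#           ≡⟨ cong (λ k → det p² k + 1#) g≡I+p ⟨
      det p² g + 1#                         ≡⟨ cong (_+ 1#) det≡d ⟩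
      d + 1#                                ∎))
      where
      g≡I+p : g ≡ I+p (quotᴹ g)
      g≡I+p = redMat≡𝟙⇒≡I+p g g↦𝟙
    ... | inj₂ (x , x-inv , hx≡xh₀) =
      Y ∙ (g ∙ X) , closed Y (g ∙ X) Y∈G (closed g X g∈G X∈G) ,
      trans (redMat-∙ Y (g ∙ X)) (trans (cong (redMat′ Y Pᴹ.∙_) (redMat-∙ g X)) (conjugates (redMat′ g) h₀ hx≡xh₀)) ,
      trans (conj-invariant (tr p²) tr-∙-comm g X Y XY≡𝟙) tr≡t ,
      trans (conj-invariant (det p²) det-∙-comm g X Y XY≡𝟙) det≡d
      where open Lift (lift x x-inv)

    kernel-element : ∀ {h₀ t₁ d₁ t₂ d₂} →
                     RepresentativeOver h₀ t₁ d₁ → RepresentativeOver h₀ t₂ d₂ →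
                     ∃ λ A → 𝔤 A × t₁ + ι (tr p (A Pᴹ.∙ h₀)) ≡ t₂ × (1# + ι (tr p A)) * d₁ ≡ d₂
    kernel-element {h₀} {t₁} {d₁} {t₂} {d₂} (g₁ , g₁∈G , g₁↦h₀ , tr₁ , det₁) (g₂ , g₂∈G , g₂↦h₀ , tr₂ , det₂)
      with inv g₁ g₁∈G
    ... | Y , Y∈G , g₁Y≡𝟙 , Yg₁≡𝟙 = A , subst G g₂Y≡I+pA (closed g₂ Y g₂∈G Y∈G) , trace , determinant
      where
      A : Mat p
      A = quotᴹ (g₂ ∙ Y)
      g₂Y≡I+pA : g₂ ∙ Y ≡ I+p A
      g₂Y≡I+pA = redMat≡𝟙⇒≡I+p (g₂ ∙ Y) (begin
        redMat′ (g₂ ∙ Y)                   ≡⟨ redMat-∙ g₂ Y ⟩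
        redMat′ g₂ Pᴹ.∙ redMat′ Y          ≡⟨ cong (Pᴹ._∙ redMat′ Y) (trans g₂↦h₀ (sym g₁↦h₀)) ⟩
        redMat′ g₁ Pᴹ.∙ redMat′ Y          ≡⟨ redMat-inverse g₁ Y g₁Y≡𝟙 ⟩
        Pᴹ.𝟙                               ∎)
      I+pA∙g₁≡g₂ : I+p A ∙ g₁ ≡ g₂
      I+pA∙g₁≡g₂ = begin
        I+p A ∙ g₁           ≡⟨ cong (_∙ g₁) g₂Y≡I+pA ⟨
        g₂ ∙ Y ∙ g₁          ≡⟨ ∙-assoc g₂ Y g₁ ⟩
        g₂ ∙ (Y ∙ g₁)        ≡⟨ cong (g₂ ∙_) Yg₁≡𝟙 ⟩
        g₂ ∙ 𝟙               ≡⟨ ∙-identityʳ g₂ ⟩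
        g₂                   ∎
      trace : t₁ + ι (tr p (A Pᴹ.∙ h₀)) ≡ t₂
      trace = begin
        t₁ + ι (tr p (A Pᴹ.∙ h₀))                 ≡⟨ cong₂ (λ t h → t + ι (tr p (A Pᴹ.∙ h))) tr₁ g₁↦h₀ ⟨
        tr p² g₁ + ι (tr p (A Pᴹ.∙ redMat′ g₁))   ≡⟨ tr-I+p-∙ A g₁ ⟨
        tr p² (I+p A ∙ g₁)                        ≡⟨ cong (tr p²) I+pA∙g₁≡g₂ ⟩
        tr p² g₂                                  ≡⟨ tr₂ ⟩
        t₂                                        ∎
      determinant : (1# + ι (tr p A)) * d₁ ≡ d₂
      determinant = begin
        (1# + ι (tr p A)) * d₁            ≡⟨ cong ((1# + ι (tr p A)) *_) det₁ ⟨
        (1# + ι (tr p A)) * det p² g₁     ≡⟨ det-I+p-∙ A g₁ ⟨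
        det p² (I+p A ∙ g₁)               ≡⟨ cong (det p²) I+pA∙g₁≡g₂ ⟩
        det p² g₂                         ≡⟨ det₂ ⟩
        d₂                                ∎

  certificate⇒GL₂⊆G : Certificate → (G : Mat p² → Set) → IsSubgroupGL₂ p² G →
                      (∀ t d → IsUnit p² d → Represents p² G t d) →
                      (∀ h → InGL₂ p h → ∃ λ g → G g × redMat′ g ≡ h) →
                      ∀ g → InGL₂ p² g → G g
  certificate⇒GL₂⊆G cert G G-subgroup represents G-onto =
    let A , 𝔤A , trace , determinant = kernel-element (representative-over t₁≢d₁+1 similar₁ (represents t₁ d₁ d₁-unit))
                                                      (representative-over t₂≢d₂+1 similar₂ (represents t₂ d₂ d₂-unit))
    in 𝔤-full⇒GL₂⊆G (λ B → generated⊆𝔤 𝔤A (generates A trace determinant B))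
    where
    open Certificate cert
    open Subgroup G G-subgroup G-onto

mat′ : ∀ {n} .{{_ : NonZero n}} → ℕ → ℕ → ℕ → ℕ → Mat n
mat′ {n} a b c d = mat ([ n ] a) ([ n ] b) ([ n ] c) ([ n ] d)

-- The lifts satisfy t₂ = t₁ + p and d₂ = (1 + p) d₁, which forces tr (A h₀) = tr A = 1. Mod 2
-- both pairs reduce to characteristic polynomial (x + 1)², realised only by I and the conjugates
-- of the transvection h₀; mod 3 to (x - 1)(x + 1), realised only by the conjugates of the swap h₀.
certificate₂ : Criterion.Certificate 2
certificate₂ = from-just (Criterion.certify 2 (mat′ 1 1 0 1) ([ 4 ] 0) ([ 4 ] 1) ([ 4 ] 2) ([ 4 ] 3) 20
  (((mat′ 1 1 0 1 , mat′ 1 1 0 1) , refl) ∷ ((mat′ 0 1 1 0 , mat′ 0 1 1 0) , refl) ∷ []))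

certificate₃ : Criterion.Certificate 3
certificate₃ = from-just (Criterion.certify 3 (mat′ 0 1 1 0) ([ 9 ] 0) ([ 9 ] 2) ([ 9 ] 3) ([ 9 ] 8) 20
  (((mat′ 1 1 0 1 , mat′ 1 2 0 1) , refl) ∷ ((mat′ 0 1 1 0 , mat′ 0 1 1 0) , refl) ∷ []))

open import Data.Nat using (_*_)

lemma14 : (p : ℕ) → .{{_ : NonZero p}} → .{{_ : NonZero (p * p)}} → (p ≡ 2 ⊎ p ≡ 3) →
    (G : Mat (p * p) → Set) → IsSubgroupGL₂ (p * p) G →
    (∀ t d → IsUnit (p * p) d → Represents (p * p) G t d) →
    (∀ (h : Mat p) → InGL₂ p h → ∃ λ g → G g × redMat (p * p) p g ≡ h) →
    ∀ (g : Mat (p * p)) → InGL₂ (p * p) g → G g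
lemma14 .2 (inj₁ refl) = Criterion.certificate⇒GL₂⊆G 2 certificate₂
lemma14 .3 (inj₂ refl) = Criterion.certificate⇒GL₂⊆G 3 certificate₃
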